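{- The nested deduction Frege system $nd\mathscr{F}$ and the nested disjunction Frege system $no\mathscr{F}$ (both built over the same classical Frege system $\mathscr{F}$) linearly simulate one another: there is an algorithm transforming any $nd\mathscr{F}$ proof of a formula $A$ with $n$ steps into an $no\mathscr{F}$ proof of $A$ with $O(n)$ steps, and an algorithm transforming any $no\mathscr{F}$ proof of $A$ with $n$ steps into an $nd\mathscr{F}$ proof of $A$ with $O(n)$ steps.
   Context: Formulas of classical propositional logic are built from variables with $\wedge,\vee,\supset,\neg$. $\mathscr{F}$ is a fixed Frege system for classical propositional logic (finitely many axiom schemas, sole rule modus ponens; e.g. Kleene's system), containing the schema $(A\supset C)\supset((B\supset C)\supset((A\vee B)\supset C))$. Nested systems: a proof is a sequence of lines, each line being a formula together with its context, a finite sequence $\Gamma$ of currently open assumptions (initially empty). A line is available to a later line if its context is an initial subsequence of the later line's context and it lies in no assumption block that has already been closed. Allowed lines: (i) an instance of an axiom schema of $\mathscr{F}$ (context unchanged); (ii) opening an assumption $A$: the line $A$ with context $\Gamma*\langle A\rangle$, where $\Gamma$ is the context of the last available line; (iii) modus ponens from available lines $A$ and $A\supset B$, giving $B$ in the current context. In $nd\mathscr{F}$ one additionally has the nested deduction rule: if a block opened by assumption $A$ in context $\Gamma*\langle A\rangle$ ends with $B$, then one may close the block and write $A\supset B$ in context $\Gamma$; the lines of the closed block become unavailable. In $no\mathscr{F}$ one instead has the nested disjunction elimination rule $\vee_{ne}$: if $A\vee B$ is available in context $\Gamma$, a block opened by assumption $A$ (context $\Gamma*\langle A\rangle$) ends with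 $C$, and a subsequent block opened by assumption $B$ (context $\Gamma*\langle B\rangle$) ends with $C$, one may close both blocks and write $C$ in context $\Gamma$; lines of the closed blocks become unavailable. A proof of $A$ is such a sequence whose last line is $A$ with empty context; the number of steps is the number of lines. -}

module Defs where

open import Data.Nat using (ℕ; zero; suc; _+_; _*_; _≤_)
open import Data.Bool using (Bool; true; false; _∧_; _∨_; not)
open import Data.List using (List; []; _∷_; concatMap; _++_)
open import Data.List.Membership.Propositional using (_∈_)
open import Data.List.Relation.Unary.All using (All)
open import Data.Maybe using (Maybe; just; nothing)
open import Data.Product using (Σ; _×_; _,_)
open import Relation.Binary.PropositionalEquality using (_≡_; _≢_)

infixr 5 _⊃_
infixr 6 _∨ᶠ_
infixr 7 _∧ᶠ_

data Fm : Set where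
  var  : ℕ → Fm
  _∧ᶠ_ : Fm → Fm → Fm
  _∨ᶠ_ : Fm → Fm → Fm
  _⊃_  : Fm → Fm → Fm
  ¬ᶠ_  : Fm → Fm

sub : (ℕ → Fm) → Fm → Fm
sub σ (var i)  = σ i
sub σ (A ∧ᶠ B) = sub σ A ∧ᶠ sub σ B
sub σ (A ∨ᶠ B) = sub σ A ∨ᶠ sub σ B
sub σ (A ⊃ B)  = sub σ A ⊃ sub σ B
sub σ (¬ᶠ A)   = ¬ᶠ sub σ A

eval : (ℕ → Bool) → Fm → Bool
eval v (var i)  = v i
eval v (A ∧ᶠ B) = eval v A ∧ eval v B
eval v (A ∨ᶠ B) = eval v A ∨ eval v B
eval v (A ⊃ B)  = not (eval v A) ∨ eval v B
eval v (¬ᶠ A)   = not (eval v A)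

Tautology : Fm → Set
Tautology A = (v : ℕ → Bool) → eval v A ≡ true

-- Frege systems: finitely many axiom schemas (a formula whose variables
-- are metavariables), sole rule modus ponens.

record Frege : Set where
  field
    axioms : List Fm

open Frege public

IsAxiom : Frege → Fm → Set
IsAxiom F A = Σ Fm λ S → (S ∈ axioms F) × Σ (ℕ → Fm) λ σ → sub σ S ≡ A

data Derivable (F : Frege) : Fm → Set where
  ax : ∀ {A} → IsAxiom F A → Derivable F A
  mp : ∀ {A B} → Derivable F A → Derivable F (A ⊃ B) → Derivable F B

record IsClassicalFrege (F : Frege) : Set where
  field
    sound    : All Tautology (axioms F)
    complete : ∀ A → Tautology A → Derivable F A

orSchema : ℕ → ℕ → ℕ → Fm
orSchema p q r = (var p ⊃ var r) ⊃ ((var q ⊃ var r) ⊃ ((var p ∨ᶠ var q) ⊃ var r))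

ContainsOrSchema : Frege → Set
ContainsOrSchema F =
  Σ ℕ λ p → Σ ℕ λ q → Σ ℕ λ r →
    (p ≢ q) × (q ≢ r) × (p ≢ r) × (orSchema p q r ∈ axioms F)

-- A proof is a sequence of lines; each rule application below writes
-- exactly ONE line.  The state records the stack of currently open
-- assumption blocks (the context of the current line, innermost first),
-- for every level the formulas of the lines written at that level that
-- are still available, and the formula of the last line written.
-- A line is available to the current line iff its context is a prefix
-- of the current context and its block has not been closed, i.e. iff it
-- is stored in some level of the current stack.

record Frame : Set where
  constructor frame
  field
    hyp     : Fm
    lines   : List Fm
    pending : Maybe (Fm × Fm)   -- (no only) a preceding finished block:
                                -- its assumption A and its last line C

record St : Set where
  constructor st
  field
    base   : List Fm
    frames : List Frame
    last   : Maybe Fm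

open Frame public
open St public

availFrames : List Frame → List Fm
availFrames = concatMap lines

avail : St → List Fm
avail s = availFrames (frames s) ++ base s

addLine : Fm → St → St
addLine A (st b []                      l) = st (A ∷ b) [] (just A)
addLine A (st b (frame h ls p ∷ fs)     l) = st b (frame h (A ∷ ls) p ∷ fs) (just A)

data Sys : Set where
  nd no : Sys

initial : St
initial = st [] [] nothing

data Step (F : Frege) : Sys → St → St → Set where
  axiom : ∀ {s σ A} → IsAxiom F A → Step F s σ (addLine A σ)
  open≻ : ∀ {s b fs l} (A : Fm) →
          Step F s (st b fs l) (st b (frame A (A ∷ []) nothing ∷ fs) (just A))
  mp    : ∀ {s σ A B} → A ∈ avail σ → (A ⊃ B) ∈ avail σ →
          Step F s σ (addLine B σ)
  ded   : ∀ {b A ls fs B} →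
          Step F nd (st b (frame A ls nothing ∷ fs) (just B))
                    (addLine (A ⊃ B) (st b fs nothing))
  -- (no only) the block opened by A has ended with C; it is closed and the
  -- subsequent block opened by assumption B (same context Γ) is opened.
  openᵛ : ∀ {b A ls fs C} (B : Fm) →
          Step F no (st b (frame A ls nothing ∷ fs) (just C))
                    (st b (frame B (B ∷ []) (just (A , C)) ∷ fs) (just B))
  ∨ne   : ∀ {b A B ls fs C} → (A ∨ᶠ B) ∈ avail (st b fs nothing) →
          Step F no (st b (frame B ls (just (A , C)) ∷ fs) (just C))
                    (addLine C (st b fs nothing))

-- sequences of steps, indexed by the number of lines written
data Steps (F : Frege) (s : Sys) : St → St → ℕ → Set where
  done : ∀ {σ} → Steps F s σ σ zero
  _▸_  : ∀ {σ τ υ n} → Step F s σ τ → Steps F s τ υ n → Steps F s σ υ (suc n)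

NProof : Frege → Sys → Fm → ℕ → Set
NProof F s A n =
  Σ St λ σ → Steps F s initial σ n × (frames σ ≡ []) × (last σ ≡ just A)

LinSim : Frege → Sys → Sys → Set
LinSim F s t =
  Σ ℕ λ c → (A : Fm) (n : ℕ) → NProof F s A n →
    Σ ℕ λ m → (m ≤ c * n) × NProof F t A m

-- Both simulations translate a proof line by line, keeping the stack of
-- open blocks of the target proof in step with that of the source.  An nd
-- block opened by A is preceded in no by a derivation of A ∨ ¬A; closing
-- it with A ⊃ B becomes a disjunction elimination on A ∨ ¬A, whose two
-- branches reach A ⊃ B from B (weakening) and from ¬A (ex falso).
-- Conversely, in nd the first branch of a no case split is closed by the
-- deduction rule, leaving A ⊃ C; closing the second one likewise gives
-- B ⊃ C, and three modus ponens from the ∨-axiom give C.  The auxiliary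
-- formulas are instances of fixed tautologies, and an instance of a fixed
-- derivation has a fixed number of lines, so each source line costs a
-- bounded number of target lines.
module Submission where

open import Defs
open import Data.Empty using (⊥-elim)
open import Data.List using (List; []; _∷_; _++_)
open import Data.List.Membership.Propositional using (_∈_)
open import Data.List.Relation.Binary.Subset.Propositional using (_⊆_)
open import Data.List.Relation.Binary.Subset.Propositional.Properties
  using (⊆-refl; ⊆-trans; ++⁺; ∷⁺ʳ)
open import Data.List.Relation.Unary.Any using (here; there)
open import Data.Bool using (true; false; not)
open import Data.Bool.Properties using (∨-zeroʳ)
open import Data.Maybe using (Maybe; just; nothing)
import Data.Maybe.Relation.Unary.All as Maybe
open import Data.Nat using (ℕ; zero; suc; _+_; _*_; _≤_; z≤n; s≤s; _⊔_; _≟_)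
open import Data.Nat.Properties using (≤-refl; ≤-trans; +-mono-≤; *-suc; m≤n+m; m≤m⊔n; m≤n⊔m)
open import Data.Product using (Σ; _×_; _,_)
open import Function using (_∘_)
open import Relation.Binary.PropositionalEquality using (_≡_; _≢_; refl; sym; trans; cong; cong₂; subst)
open import Relation.Nullary using (yes) renaming (no to no′)

variable
  F : Frege
  s t : Sys
  A B C : Fm
  b b′ b″ ls ls′ : List Fm
  fs fs′ fs″ : List Frame
  p : Maybe (Fm × Fm)
  σ σ′ τ : St

infixr 5 _++ˢ_

_++ˢ_ : ∀ {σ τ υ m n} → Steps F s σ τ m → Steps F s τ υ n → Steps F s σ υ (m + n)
done     ++ˢ ys = ys
(x ▸ xs) ++ˢ ys = x ▸ (xs ++ˢ ys)

openBlock : Fm → Maybe (Fm × Fm) → St → St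
openBlock A p τ = st (base τ) (frame A (A ∷ []) p ∷ frames τ) (just A)

addLine-∈ : A ∈ avail (addLine A σ)
addLine-∈ {σ = st _ [] _}      = here refl
addLine-∈ {σ = st _ (_ ∷ _) _} = here refl

data Extends : List Frame → List Fm → List Frame → List Fm → Set where
  base≼  : b ⊆ b′ → Extends [] b [] b′
  frame≼ : ∀ {h} → ls ⊆ ls′ → Extends fs b fs′ b′ →
           Extends (frame h ls p ∷ fs) b (frame h ls′ p ∷ fs′) b′

_≼_ : St → St → Set
σ ≼ τ = Extends (frames σ) (base σ) (frames τ) (base τ)

≼-base : Extends fs b fs′ b′ → b ⊆ b′
≼-base (base≼ b⊆)     = b⊆
≼-base (frame≼ _ fs≼) = ≼-base fs≼

≼-frames : Extends fs b fs′ b′ → availFrames fs ⊆ availFrames fs′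
≼-frames (base≼ _)         = ⊆-refl
≼-frames (frame≼ ls⊆ fs≼) = ++⁺ ls⊆ (≼-frames fs≼)

≼-avail : Extends fs b fs′ b′ → avail (st b fs nothing) ⊆ avail (st b′ fs′ nothing)
≼-avail fs≼ = ++⁺ (≼-frames fs≼) (≼-base fs≼)

Extends-refl : Extends fs b fs b
Extends-refl {fs = []}    = base≼ ⊆-refl
Extends-refl {fs = _ ∷ _} = frame≼ ⊆-refl Extends-refl

Extends-trans : Extends fs b fs′ b′ → Extends fs′ b′ fs″ b″ → Extends fs b fs″ b″
Extends-trans (base≼ p)    (base≼ q)    = base≼ (⊆-trans p q)
Extends-trans (frame≼ p e) (frame≼ q f) = frame≼ (⊆-trans p q) (Extends-trans e f)

addLine-≼ : σ ≼ addLine A σ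
addLine-≼ {σ = st _ [] _}      = base≼ there
addLine-≼ {σ = st _ (_ ∷ _) _} = frame≼ there Extends-refl

addLine-⊆ : avail σ ⊆ avail (addLine A σ)
addLine-⊆ {σ = σ} {A = A} = ≼-avail (addLine-≼ {σ = σ} {A = A})

size : Derivable F A → ℕ
size (ax _)   = 1
size (mp d e) = size d + (size e + 1)

sub-∘ : ∀ ρ π A → sub ρ (sub π A) ≡ sub (sub ρ ∘ π) A
sub-∘ ρ π (var i)  = refl
sub-∘ ρ π (A ∧ᶠ B) = cong₂ _∧ᶠ_ (sub-∘ ρ π A) (sub-∘ ρ π B)
sub-∘ ρ π (A ∨ᶠ B) = cong₂ _∨ᶠ_ (sub-∘ ρ π A) (sub-∘ ρ π B)
sub-∘ ρ π (A ⊃ B)  = cong₂ _⊃_ (sub-∘ ρ π A) (sub-∘ ρ π B)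
sub-∘ ρ π (¬ᶠ A)   = cong ¬ᶠ_ (sub-∘ ρ π A)

writeInstance : ∀ ρ (D : Derivable F A) τ →
                Σ St λ τ′ → Steps F t τ τ′ (size D) × τ ≼ τ′ × sub ρ A ∈ avail τ′
writeInstance ρ (ax (S , S∈ , π , refl)) τ =
  addLine _ τ , axiom (S , S∈ , sub ρ ∘ π , sym (sub-∘ ρ π S)) ▸ done , addLine-≼ , addLine-∈ {σ = τ}
writeInstance ρ (mp d e) τ with writeInstance ρ d τ
... | τ₁ , ds , τ≼τ₁ , x∈ with writeInstance ρ e τ₁
... | τ₂ , es , τ₁≼τ₂ , x⊃y∈ =
  addLine _ τ₂ , ds ++ˢ es ++ˢ mp (≼-avail τ₁≼τ₂ x∈) x⊃y∈ ▸ done ,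
  Extends-trans τ≼τ₁ (Extends-trans τ₁≼τ₂ addLine-≼) , addLine-∈ {σ = τ₂}

writeDetachment : ∀ ρ {X Y} (D : Derivable F (X ⊃ Y)) → sub ρ X ∈ avail τ →
                  Σ St λ τ′ → Steps F t τ (addLine (sub ρ Y) τ′) (size D + 1) × τ ≼ τ′
writeDetachment ρ D x∈ with writeInstance ρ D _
... | τ′ , ws , τ≼τ′ , x⊃y∈ = τ′ , ws ++ˢ mp (≼-avail τ≼τ′ x∈) x⊃y∈ ▸ done , τ≼τ′

-- The target has the source's blocks, with the same assumptions and at
-- least the same lines, but no pending first branch; Inv h p Γ is what the
-- target must have available in the context Γ enclosing a source block
-- with assumption h and pending first branch p.
module Simulation (Inv : Fm → Maybe (Fm × Fm) → List Fm → Set)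
                  (Inv-mono : ∀ {h q Γ Δ} → Γ ⊆ Δ → Inv h q Γ → Inv h q Δ) where

  data Simulates : List Frame → List Fm → List Frame → List Fm → Set where
    base⊑  : b ⊆ b′ → Simulates [] b [] b′
    frame⊑ : ∀ {h} → ls ⊆ ls′ → Inv h p (availFrames fs′ ++ b′) → Simulates fs b fs′ b′ →
             Simulates (frame h ls p ∷ fs) b (frame h ls′ nothing ∷ fs′) b′

  _⊑_ : St → St → Set
  σ ⊑ τ = Simulates (frames σ) (base σ) (frames τ) (base τ)

  ⊑-base : Simulates fs b fs′ b′ → b ⊆ b′
  ⊑-base (base⊑ b⊆)       = b⊆
  ⊑-base (frame⊑ _ _ fs⊑) = ⊑-base fs⊑

  ⊑-frames : Simulates fs b fs′ b′ → availFrames fs ⊆ availFrames fs′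
  ⊑-frames (base⊑ _)           = ⊆-refl
  ⊑-frames (frame⊑ ls⊆ _ fs⊑) = ++⁺ ls⊆ (⊑-frames fs⊑)

  ⊑-avail : Simulates fs b fs′ b′ → avail (st b fs nothing) ⊆ avail (st b′ fs′ nothing)
  ⊑-avail fs⊑ = ++⁺ (⊑-frames fs⊑) (⊑-base fs⊑)

  ⊑-≼ : Simulates fs b fs′ b′ → Extends fs′ b′ fs″ b″ → Simulates fs b fs″ b″
  ⊑-≼ (base⊑ p)          (base≼ q)    = base⊑ (⊆-trans p q)
  ⊑-≼ (frame⊑ p inv fs⊑) (frame≼ q e) = frame⊑ (⊆-trans p q) (Inv-mono (≼-avail e) inv) (⊑-≼ fs⊑ e)

  ⊑-closed : Simulates fs b fs′ b′ → fs ≡ [] → fs′ ≡ []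
  ⊑-closed (base⊑ _) _ = refl

  Tracks : St → St → Set
  Tracks σ τ = σ ⊑ τ × last σ ≡ last τ × (∀ {X} → last τ ≡ just X → X ∈ avail τ)

  tracks-addLine : σ ⊑ τ → Tracks (addLine A σ) (addLine A τ)
  tracks-addLine {σ = st _ [] _}      {st _ [] _}      (base⊑ b⊆) =
    base⊑ (∷⁺ʳ _ b⊆) , refl , λ { refl → here refl }
  tracks-addLine {σ = st _ (_ ∷ _) _} {st _ (_ ∷ _) _} (frame⊑ ls⊆ inv fs⊑) =
    frame⊑ (∷⁺ʳ _ ls⊆) inv fs⊑ , refl , λ { refl → here refl }

  tracks-open : Simulates fs b fs′ b′ → Inv A p (avail (st b′ fs′ nothing)) →
                Tracks (st b (frame A (A ∷ []) p ∷ fs) (just A)) (st b′ (frame A (A ∷ []) nothing ∷ fs′) (just A))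
  tracks-open σ⊑τ inv = frame⊑ ⊆-refl inv σ⊑τ , refl , λ { refl → here refl }

  tracks-initial : Tracks initial initial
  tracks-initial = base⊑ ⊆-refl , refl , λ ()

  module _ (F : Frege) (s t : Sys) where

    CatchUp : ℕ → St → St → Set
    CatchUp k τ σ′ = Σ St λ τ′ → Steps F t τ τ′ k × Tracks σ′ τ′

    StepSimulation : ℕ → Set
    StepSimulation c = ∀ {σ σ′} → Step F s σ σ′ → ∀ τ → Tracks σ τ → Σ ℕ λ k → k ≤ c × CatchUp k τ σ′

    copy-axiom : IsAxiom F A → Tracks σ τ → CatchUp 1 τ (addLine A σ)
    copy-axiom x (σ⊑τ , _) = _ , axiom x ▸ done , tracks-addLine σ⊑τ

    copy-mp : A ∈ avail σ → (A ⊃ B) ∈ avail σ → Tracks σ τ → CatchUp 1 τ (addLine B σ)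
    copy-mp a∈ a⊃b∈ (σ⊑τ , _) = _ , mp (⊑-avail σ⊑τ a∈) (⊑-avail σ⊑τ a⊃b∈) ▸ done , tracks-addLine σ⊑τ

    module _ {c : ℕ} (step : StepSimulation c) where

      simulate : ∀ {n} → Steps F s σ σ′ n → Tracks σ τ → Σ ℕ λ m → m ≤ c * n × CatchUp m τ σ′
      simulate done tr = 0 , z≤n , _ , done , tr
      simulate {n = suc n} (x ▸ xs) tr with step x _ tr
      ... | k , k≤c , _ , ys , tr₁ with simulate xs tr₁
      ... | m , m≤ , τ₂ , zs , tr₂ =
        k + m , subst (k + m ≤_) (sym (*-suc c n)) (+-mono-≤ k≤c m≤) , τ₂ , ys ++ˢ zs , tr₂

      linSim : LinSim F s t
      linSim = c , λ A n → λ { (σ , xs , closed , ends) → translate xs closed ends }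
        where
        translate : ∀ {σ n} → Steps F s initial σ n → frames σ ≡ [] → last σ ≡ just A →
                    Σ ℕ λ m → m ≤ c * n × NProof F t A m
        translate xs closed ends with simulate xs tracks-initial
        ... | m , m≤ , τ , ys , (σ⊑τ , last≡ , _) =
          m , m≤ , τ , ys , ⊑-closed σ⊑τ closed , trans (sym last≡) ends

excludedMiddle exFalso weakening : Fm
excludedMiddle = var 0 ∨ᶠ ¬ᶠ var 0
exFalso        = ¬ᶠ var 0 ⊃ (var 0 ⊃ var 1)
weakening      = var 1 ⊃ (var 0 ⊃ var 1)

excludedMiddle-valid : Tautology excludedMiddle
excludedMiddle-valid v with v 0
... | true  = refl
... | false = refl

exFalso-valid : Tautology exFalso
exFalso-valid v with v 0
... | true  = refl
... | false = refl

weakening-valid : Tautology weakening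
weakening-valid v with v 1
... | true  = ∨-zeroʳ (not (v 0))
... | false = refl

⟦_,_⟧ : Fm → Fm → ℕ → Fm
⟦ A , B ⟧ zero    = A
⟦ A , B ⟧ (suc _) = B

module DeductionToDisjunction (F : Frege) (classical : IsClassicalFrege F) where
  open IsClassicalFrege classical
  open Simulation (λ h _ Γ → (h ∨ᶠ ¬ᶠ h) ∈ Γ) (λ Γ⊆ → Γ⊆)

  excludedMiddle-derivation : Derivable F excludedMiddle
  excludedMiddle-derivation = complete _ excludedMiddle-valid

  exFalso-derivation : Derivable F exFalso
  exFalso-derivation = complete _ exFalso-valid

  weakening-derivation : Derivable F weakening
  weakening-derivation = complete _ weakening-valid

  openCost closeCost cost : ℕ
  openCost  = size excludedMiddle-derivation + 1
  closeCost = (size weakening-derivation + 1) + suc ((size exFalso-derivation + 1) + 1)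
  cost      = openCost ⊔ closeCost

  closeBlock : ∀ {b A ls fs B} τ → Tracks (st b (frame A ls nothing ∷ fs) (just B)) τ →
               CatchUp F nd no closeCost τ (addLine (A ⊃ B) (st b fs nothing))
  closeBlock {A = A} {B = B} τ@(st b′ (_ ∷ fs′) _) (frame⊑ _ em∈ fs⊑ , refl , lastAvail)
    with writeDetachment {τ = τ} ⟦ A , B ⟧ weakening-derivation (lastAvail refl)
  ... | st b₁ (frame _ _ _ ∷ fs₁) _ , ws₁ , frame≼ _ e₁
    with writeDetachment {τ = openBlock (¬ᶠ A) (just (A , A ⊃ B)) (st b₁ fs₁ nothing)}
                         ⟦ A , B ⟧ exFalso-derivation (here refl)
  ... | st b₂ (frame _ _ _ ∷ fs₂) _ , ws₂ , frame≼ _ e₂ =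
    addLine (A ⊃ B) (st b₂ fs₂ nothing) ,
    ws₁ ++ˢ openᵛ (¬ᶠ A) ▸ (ws₂ ++ˢ ∨ne (≼-avail e₁₂ em∈) ▸ done) ,
    tracks-addLine (⊑-≼ fs⊑ e₁₂)
    where
    e₁₂ : Extends fs′ b′ fs₂ b₂
    e₁₂ = Extends-trans e₁ e₂

  1≤cost : 1 ≤ cost
  1≤cost = ≤-trans (m≤n+m 1 _) (m≤m⊔n openCost _)

  step : StepSimulation F nd no cost
  step (axiom x)  _ tr = 1 , 1≤cost , copy-axiom F nd no x tr
  step (mp a b)   _ tr = 1 , 1≤cost , copy-mp F nd no a b tr
  step (open≻ A) τ (σ⊑τ , _) with writeInstance ⟦ A , A ⟧ excludedMiddle-derivation τ
  ... | τ₁ , ws , τ≼τ₁ , em∈ =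
    openCost , m≤m⊔n _ _ , openBlock A nothing τ₁ , ws ++ˢ open≻ A ▸ done ,
    tracks-open (⊑-≼ σ⊑τ τ≼τ₁) em∈
  step ded        τ tr = closeCost , m≤n⊔m openCost _ , closeBlock τ tr

  linSim-nd-no : LinSim F nd no
  linSim-nd-no = linSim F nd no step

module DisjunctionToDeduction (F : Frege) {p q r : ℕ} (p≢q : p ≢ q) (q≢r : q ≢ r) (p≢r : p ≢ r)
                              (orSchema∈ : orSchema p q r ∈ axioms F) where

  orSubst : Fm → Fm → Fm → ℕ → Fm
  orSubst A B C i with i ≟ p
  ... | yes _ = A
  ... | no′ _ with i ≟ q
  ...   | yes _ = B
  ...   | no′ _ = C

  orSubst-p : orSubst A B C p ≡ A
  orSubst-p with p ≟ p
  ... | yes _    = refl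
  ... | no′ p≢p = ⊥-elim (p≢p refl)

  orSubst-q : orSubst A B C q ≡ B
  orSubst-q with q ≟ p
  ... | yes q≡p = ⊥-elim (p≢q (sym q≡p))
  ... | no′ _ with q ≟ q
  ...   | yes _    = refl
  ...   | no′ q≢q = ⊥-elim (q≢q refl)

  orSubst-r : orSubst A B C r ≡ C
  orSubst-r with r ≟ p
  ... | yes r≡p = ⊥-elim (p≢r (sym r≡p))
  ... | no′ _ with r ≟ q
  ...   | yes r≡q = ⊥-elim (q≢r (sym r≡q))
  ...   | no′ _   = refl

  orAxiom : IsAxiom F ((A ⊃ C) ⊃ ((B ⊃ C) ⊃ ((A ∨ᶠ B) ⊃ C)))
  orAxiom {A} {C} {B} = orSchema p q r , orSchema∈ , orSubst A B C , instance≡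
    where
    instance≡ : sub (orSubst A B C) (orSchema p q r) ≡ ((A ⊃ C) ⊃ ((B ⊃ C) ⊃ ((A ∨ᶠ B) ⊃ C)))
    instance≡ rewrite orSubst-p {A} {B} {C} | orSubst-q {A} {B} {C} | orSubst-r {A} {B} {C} = refl

  open Simulation (λ _ pending Γ → Maybe.All (λ (A , C) → (A ⊃ C) ∈ Γ) pending) (λ Γ⊆ → Maybe.map Γ⊆)

  switchBlock : ∀ {b A ls fs C} B τ → Tracks (st b (frame A ls nothing ∷ fs) (just C)) τ →
                CatchUp F no nd 2 τ (st b (frame B (B ∷ []) (just (A , C)) ∷ fs) (just B))
  switchBlock {A = A} {C = C} B (st b′ (_ ∷ fs′) _) (frame⊑ _ _ fs⊑ , refl , _) =
    openBlock B nothing τ₁ , ded ▸ (open≻ B ▸ done) ,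
    tracks-open (⊑-≼ fs⊑ (addLine-≼ {σ = τ₀})) (Maybe.just (addLine-∈ {σ = τ₀}))
    where
    τ₀ τ₁ : St
    τ₀ = st b′ fs′ nothing
    τ₁ = addLine (A ⊃ C) τ₀

  joinBlocks : ∀ {b A B ls fs C} τ → (A ∨ᶠ B) ∈ avail (st b fs nothing) →
               Tracks (st b (frame B ls (just (A , C)) ∷ fs) (just C)) τ →
               CatchUp F no nd 5 τ (addLine C (st b fs nothing))
  joinBlocks {A = A} {B} {C = C} (st b′ (_ ∷ fs′) _) a∨b∈ (frame⊑ _ (Maybe.just a⊃c∈) fs⊑ , refl , _) =
    addLine C τ₄ ,
    ded ▸ (axiom orAxiom ▸ (mp (up τ₁ (up τ₀ a⊃c∈)) (addLine-∈ {σ = τ₁}) ▸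
      (mp (up τ₂ (up τ₁ (addLine-∈ {σ = τ₀}))) (addLine-∈ {σ = τ₂}) ▸
      (mp (up τ₃ (up τ₂ (up τ₁ (up τ₀ (⊑-avail fs⊑ a∨b∈))))) (addLine-∈ {σ = τ₃}) ▸ done)))) ,
    tracks-addLine (⊑-≼ fs⊑ (Extends-trans addLine-≼ (Extends-trans addLine-≼
                              (Extends-trans addLine-≼ (addLine-≼ {σ = τ₃})))))
    where
    up : ∀ σ {X} → avail σ ⊆ avail (addLine X σ)
    up σ = addLine-⊆ {σ = σ}
    τ₀ τ₁ τ₂ τ₃ τ₄ : St
    τ₀ = st b′ fs′ nothing
    τ₁ = addLine (B ⊃ C) τ₀
    τ₂ = addLine ((A ⊃ C) ⊃ ((B ⊃ C) ⊃ ((A ∨ᶠ B) ⊃ C))) τ₁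
    τ₃ = addLine ((B ⊃ C) ⊃ ((A ∨ᶠ B) ⊃ C)) τ₂
    τ₄ = addLine ((A ∨ᶠ B) ⊃ C) τ₃

  step : StepSimulation F no nd 5
  step (axiom x)   _ tr        = 1 , s≤s z≤n , copy-axiom F no nd x tr
  step (mp a b)    _ tr        = 1 , s≤s z≤n , copy-mp F no nd a b tr
  step (open≻ A) τ (σ⊑τ , _) =
    1 , s≤s z≤n , openBlock A nothing τ , open≻ A ▸ done , tracks-open σ⊑τ Maybe.nothing
  step (openᵛ B)   τ tr        = 2 , s≤s (s≤s z≤n) , switchBlock B τ tr
  step (∨ne a∨b∈)  τ tr        = 5 , ≤-refl , joinBlocks τ a∨b∈ tr

  linSim-no-nd : LinSim F no nd
  linSim-no-nd = linSim F no nd step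

theorem6 : (F : Frege) → IsClassicalFrege F → ContainsOrSchema F →
    LinSim F nd no × LinSim F no nd
theorem6 F classical (_ , _ , _ , p≢q , q≢r , p≢r , orSchema∈) =
  DeductionToDisjunction.linSim-nd-no F classical ,
  DisjunctionToDeduction.linSim-no-nd F p≢q q≢r p≢r orSchema∈
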